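{- Let $f$ be a biarithmetic IASI of a graph $G$. Then $f$ is a strong IASI of $G$ (i.e. $|f^+(uv)|=|f(u)|\,|f(v)|$ for every edge $uv$) if and only if for every edge $uv$ of $G$, where $u$ is the end vertex with the smaller deterministic index, the deterministic ratio of $uv$ equals $|f(u)|$.
   Context: All graphs are simple and finite with no isolated vertices. Let $\mathbb{N}_0$ be the set of non-negative integers and $\mathcal{P}(\mathbb{N}_0)$ its power set; label sets are finite and non-empty. For sets $A,B$, $A+B=\{a+b: a\in A, b\in B\}$. An integer additive set-indexer (IASI) of $G$ is an injective map $f:V(G)\to\mathcal{P}(\mathbb{N}_0)$ such that $f^+:E(G)\to\mathcal{P}(\mathbb{N}_0)$, $f^+(uv)=f(u)+f(v)$, is also injective. An AP-set is a finite set of integers with at least three elements forming an arithmetic progression; its common difference is the deterministic index of the element it labels. An IASI is arithmetic if all vertex labels and edge labels are AP-sets. The deterministic ratio of an edge is the ratio ($\ge 1$) of the larger to the smaller deterministic index of its end vertices. A biarithmetic IASI is an arithmetic IASI $f$ such that for every edge $uv$, writing $d_u\le d_v$ for the deterministic indices of its ends, $d_v=k\,d_u$ for some integer $k$ with $1<k\le |f(u)|$ (so $d_u<d_v$). -}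

module Defs where

open import Data.Nat using (ℕ; _+_; _*_; _≤_; _<_)
open import Data.Nat.Properties using (_≟_)
open import Data.Fin using (Fin)
open import Data.List using (List; []; _∷_; map; upTo; length; deduplicate; cartesianProductWith)
open import Data.List.Membership.Propositional using (_∈_)
open import Data.Product using (Σ; ∃; _×_; _,_)
open import Data.Sum using (_⊎_)
open import Data.Empty using (⊥)
open import Function.Bundles using (_⇔_)
open import Relation.Binary.PropositionalEquality using (_≡_)
open import Relation.Nullary using (¬_)

-- Finite sets of non-negative integers, represented by lists
-- (duplicates allowed; sets are compared extensionally).

FinSet : Set
FinSet = List ℕ

_≈ₛ_ : FinSet → FinSet → Set
S ≈ₛ T = ∀ x → (x ∈ S) ⇔ (x ∈ T)

NonEmpty : FinSet → Set
NonEmpty S = ∃ λ x → x ∈ S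

card : FinSet → ℕ
card S = length (deduplicate _≟_ S)

_⊕_ : FinSet → FinSet → FinSet
A ⊕ B = cartesianProductWith _+_ A B

record Graph (n : ℕ) : Set₁ where
  field
    Adj       : Fin n → Fin n → Set
    sym       : ∀ {u v} → Adj u v → Adj v u
    irrefl    : ∀ {u} → ¬ Adj u u
    noIsolated : ∀ v → ∃ λ u → Adj v u
open Graph public

Labelling : ℕ → Set
Labelling n = Fin n → FinSet

edgeLabel : ∀ {n} → Labelling n → Fin n → Fin n → FinSet
edgeLabel f u v = f u ⊕ f v

record IsIASI {n : ℕ} (G : Graph n) (f : Labelling n) : Set where
  field
    nonEmpty   : ∀ v → NonEmpty (f v)
    injective  : ∀ u v → f u ≈ₛ f v → u ≡ v
    edgeInjective : ∀ {u v x y} → Adj G u v → Adj G x y →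
                    edgeLabel f u v ≈ₛ edgeLabel f x y →
                    (u ≡ x × v ≡ y) ⊎ (u ≡ y × v ≡ x)

DetIndex : FinSet → ℕ → Set
DetIndex S d = Σ ℕ λ a → Σ ℕ λ m →
  (3 ≤ m) × (1 ≤ d) × (S ≈ₛ map (λ i → a + i * d) (upTo m))

IsAPSet : FinSet → Set
IsAPSet S = ∃ λ d → DetIndex S d

record IsArithmeticIASI {n : ℕ} (G : Graph n) (f : Labelling n) : Set where
  field
    iasi      : IsIASI G f
    vertexAP  : ∀ v → IsAPSet (f v)
    edgeAP    : ∀ {u v} → Adj G u v → IsAPSet (edgeLabel f u v)

record IsBiarithmeticIASI {n : ℕ} (G : Graph n) (f : Labelling n) : Set where
  field
    arithmetic : IsArithmeticIASI G f
    ratio : ∀ {u v} → Adj G u v → ∀ {du dv} →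
            DetIndex (f u) du → DetIndex (f v) dv → du ≤ dv →
            ∃ λ k → (dv ≡ k * du) × (1 < k) × (k ≤ card (f u))

IsStrongIASI : ∀ {n} (G : Graph n) (f : Labelling n) → Set
IsStrongIASI G f = IsIASI G f ×
  (∀ {u v} → Adj G u v → card (edgeLabel f u v) ≡ card (f u) * card (f v))

-- The deterministic ratio of the edge uv (u the end with smaller
-- deterministic index) equals |f(u)|, i.e. d_v / d_u = |f(u)|,
-- stated multiplicatively as d_v = |f(u)| * d_u (d_u ≥ 1).
RatioEqualsCard : ∀ {n} (G : Graph n) (f : Labelling n) → Set
RatioEqualsCard G f = ∀ {u v} → Adj G u v → ∀ {du dv} →
  DetIndex (f u) du → DetIndex (f v) dv → du ≤ dv →
  dv ≡ card (f u) * du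

module Submission where

open import Defs hiding (sym)
open import Data.Nat using (ℕ; zero; suc; _+_; _*_; _≤_; _<_; z≤n; s≤s; _<?_; >-nonZero)
open import Data.Nat.Properties
open import Data.Nat.Tactic.RingSolver using (solve-∀)
open import Data.List using (map; upTo; length; deduplicate)
open import Data.List.Properties using (length-map; length-upTo)
open import Data.List.Membership.Propositional using (_∈_)
open import Data.List.Membership.Propositional.Properties
  using (∈-map⁺; ∈-map⁻; ∈-upTo⁺; ∈-upTo⁻; ∈-cartesianProductWith⁺; ∈-cartesianProductWith⁻; deduplicate-∈⇔)
open import Data.List.Membership.Propositional.Properties.WithK using (unique∧set⇒bag)
open import Data.List.Relation.Unary.Unique.Propositional using (Unique)
import Data.List.Relation.Unary.Unique.Propositional.Properties as Unique
open import Data.List.Relation.Unary.Unique.DecPropositional.Properties _≟_ using (deduplicate-!)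
open import Data.List.Relation.Binary.BagAndSetEquality using (∼bag⇒↭)
open import Data.List.Relation.Binary.Permutation.Propositional.Properties using (↭-length)
open import Data.Product using (∃; ∃₂; _×_; _,_; proj₁; proj₂)
open import Data.Sum using (inj₁; inj₂)
open import Function.Bundles using (_⇔_; mk⇔; Equivalence)
import Function.Properties.Equivalence as ⇔
open import Relation.Binary.PropositionalEquality
  using (_≡_; refl; sym; trans; cong; cong₂; subst; module ≡-Reasoning)
open import Relation.Nullary using (yes; no)

-- Write f(u) = {a + i d : i < m} and f(v) = {b + j k d : j ≤ q} with k ≤ m.
-- Then the sums a + b + (i + k j) d cover every index below m + k q, so
-- |f(u) + f(v)| = m + k q, which equals m (q + 1) = |f(u)| |f(v)| exactly
-- when k = m.

≈ₛ-sym : ∀ {A B} → A ≈ₛ B → B ≈ₛ A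
≈ₛ-sym A≈B x = ⇔.sym (A≈B x)

≈ₛ-trans : ∀ {A B C} → A ≈ₛ B → B ≈ₛ C → A ≈ₛ C
≈ₛ-trans A≈B B≈C x = ⇔.trans (A≈B x) (B≈C x)

⊕-cong : ∀ {A A′ B B′} → A ≈ₛ A′ → B ≈ₛ B′ → (A ⊕ B) ≈ₛ (A′ ⊕ B′)
⊕-cong A≈A′ B≈B′ x = mk⇔ (transport A≈A′ B≈B′) (transport (≈ₛ-sym A≈A′) (≈ₛ-sym B≈B′))
  where
  transport : ∀ {C C′ D D′} → C ≈ₛ C′ → D ≈ₛ D′ → x ∈ (C ⊕ D) → x ∈ (C′ ⊕ D′)
  transport {C} {D = D} C≈C′ D≈D′ x∈ with ∈-cartesianProductWith⁻ _+_ C D x∈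
  ... | c , d , c∈ , d∈ , refl =
    ∈-cartesianProductWith⁺ _+_ (Equivalence.to (C≈C′ c) c∈) (Equivalence.to (D≈D′ d) d∈)

⊕-comm : ∀ A B → (A ⊕ B) ≈ₛ (B ⊕ A)
⊕-comm A B x = mk⇔ (swap A B) (swap B A)
  where
  swap : ∀ C D → x ∈ (C ⊕ D) → x ∈ (D ⊕ C)
  swap C D x∈ with ∈-cartesianProductWith⁻ _+_ C D x∈
  ... | c , d , c∈ , d∈ , refl = subst (_∈ (D ⊕ C)) (+-comm d c) (∈-cartesianProductWith⁺ _+_ d∈ c∈)

length-unique-≈ : ∀ {xs ys} → Unique xs → Unique ys → xs ≈ₛ ys → length xs ≡ length ys
length-unique-≈ xs! ys! xs≈ys = ↭-length (∼bag⇒↭ (unique∧set⇒bag xs! ys! (λ {x} → xs≈ys x)))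

deduplicate-≈ : ∀ xs → deduplicate _≟_ xs ≈ₛ xs
deduplicate-≈ xs x = ⇔.sym (deduplicate-∈⇔ _≟_)

card-cong : ∀ {S T} → S ≈ₛ T → card S ≡ card T
card-cong {S} {T} S≈T = length-unique-≈ (deduplicate-! S) (deduplicate-! T)
  (≈ₛ-trans (deduplicate-≈ S) (≈ₛ-trans S≈T (≈ₛ-sym (deduplicate-≈ T))))

card-unique : ∀ {xs} → Unique xs → card xs ≡ length xs
card-unique {xs} xs! = length-unique-≈ (deduplicate-! xs) xs! (deduplicate-≈ xs)

ap : ℕ → ℕ → ℕ → FinSet
ap a d m = map (λ i → a + i * d) (upTo m)

∈-ap⁺ : ∀ {a d m i} → i < m → a + i * d ∈ ap a d m
∈-ap⁺ {a} {d} i<m = ∈-map⁺ (λ i → a + i * d) (∈-upTo⁺ i<m)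

∈-ap⁻ : ∀ {a d m x} → x ∈ ap a d m → ∃ λ i → i < m × x ≡ a + i * d
∈-ap⁻ {a} {d} x∈ with ∈-map⁻ (λ i → a + i * d) x∈
... | i , i∈ , x≡ = i , ∈-upTo⁻ i∈ , x≡

card-ap : ∀ {a d m} → 1 ≤ d → card (ap a d m) ≡ m
card-ap {a} {suc d} {m} _ = begin
  card (ap a (suc d) m)   ≡⟨ card-unique (Unique.map⁺ term-injective (Unique.upTo⁺ m)) ⟩
  length (ap a (suc d) m) ≡⟨ length-map _ (upTo m) ⟩
  length (upTo m)         ≡⟨ length-upTo m ⟩
  m                       ∎
  where
  open ≡-Reasoning
  term-injective : ∀ {i j} → a + i * suc d ≡ a + j * suc d → i ≡ j
  term-injective {i} {j} eq = *-cancelʳ-≡ i j (suc d) (+-cancelˡ-≡ a _ _ eq)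

m+n*0≡m : ∀ m n → m + n * 0 ≡ m
m+n*0≡m m n = trans (cong (m +_) (*-zeroʳ n)) (+-identityʳ m)

-- Mixed-radix digits: an index below m + k q splits as i + k j with the
-- low digit i < m and the high digit j ≤ q, because k ≤ m.
split-index : ∀ {k m} → k ≤ m → ∀ q {t} → t < m + k * q →
              ∃₂ λ i j → i < m × j ≤ q × t ≡ i + k * j
split-index {k} {m} k≤m zero {t} t<m+k*0 =
  t , 0 , subst (t <_) (m+n*0≡m m k) t<m+k*0 , z≤n , sym (m+n*0≡m t k)
split-index {k} {m} k≤m (suc q) {t} t<m+k*[1+q] with t <? k
... | yes t<k = t , 0 , <-≤-trans t<k k≤m , z≤n , sym (m+n*0≡m t k)
... | no t≮k with t′ , refl ← m≤n⇒∃[o]m+o≡n (≮⇒≥ t≮k)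
  = lift-digit (split-index k≤m q (+-cancelˡ-< k t′ _ (subst (k + t′ <_) (shift m k q) t<m+k*[1+q])))
  where
  shift : ∀ m k q → m + k * suc q ≡ k + (m + k * q)
  shift = solve-∀
  carry : ∀ k i j → k + (i + k * j) ≡ i + k * suc j
  carry = solve-∀
  lift-digit : (∃₂ λ i j → i < m × j ≤ q × t′ ≡ i + k * j) →
               ∃₂ λ i j → i < m × j ≤ suc q × k + t′ ≡ i + k * j
  lift-digit (i , j , i<m , j≤q , refl) = i , suc j , i<m , s≤s j≤q , carry k i j

ap-⊕-ap : ∀ a b d {k m} q → k ≤ m → (ap a d m ⊕ ap b (k * d) (suc q)) ≈ₛ ap (a + b) d (m + k * q)
ap-⊕-ap a b d {k} {m} q k≤m x = mk⇔ sum∈ ∈sum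
  where
  sum-of-terms : ∀ a b d k i j → a + i * d + (b + j * (k * d)) ≡ a + b + (i + k * j) * d
  sum-of-terms = solve-∀
  sum∈ : x ∈ (ap a d m ⊕ ap b (k * d) (suc q)) → x ∈ ap (a + b) d (m + k * q)
  sum∈ x∈ with ∈-cartesianProductWith⁻ _+_ (ap a d m) (ap b (k * d) (suc q)) x∈
  ... | _ , _ , y∈ , z∈ , refl with ∈-ap⁻ y∈ | ∈-ap⁻ z∈
  ... | i , i<m , refl | j , s≤s j≤q , refl =
    subst (_∈ ap (a + b) d (m + k * q)) (sym (sum-of-terms a b d k i j)) (∈-ap⁺ (+-mono-<-≤ i<m (*-monoʳ-≤ k j≤q)))
  ∈sum : x ∈ ap (a + b) d (m + k * q) → x ∈ (ap a d m ⊕ ap b (k * d) (suc q))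
  ∈sum x∈ with ∈-ap⁻ x∈
  ... | t , t< , refl with split-index k≤m q t<
  ... | i , j , i<m , j≤q , refl =
    subst (_∈ (ap a d m ⊕ ap b (k * d) (suc q))) (sum-of-terms a b d k i j)
      (∈-cartesianProductWith⁺ _+_ (∈-ap⁺ i<m) (∈-ap⁺ (s≤s j≤q)))

card-DetIndex : ∀ {S d} (D : DetIndex S d) → card S ≡ proj₁ (proj₂ D)
card-DetIndex (_ , _ , _ , 1≤d , S≈) = trans (card-cong S≈) (card-ap 1≤d)

DetIndex⇒3≤card : ∀ {S d} → DetIndex S d → 3 ≤ card S
DetIndex⇒3≤card D@(_ , _ , 3≤m , _ , _) = subst (3 ≤_) (sym (card-DetIndex D)) 3≤m

-- Stated with "+ k" on the left, this avoids the truncated subtraction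
-- |S ⊕ T| = |S| + k (|T| - 1).
card-⊕-DetIndex : ∀ {S T d k} → DetIndex S d → DetIndex T (k * d) → k ≤ card S →
                  card (S ⊕ T) + k ≡ card S + k * card T
card-⊕-DetIndex {S} {T} {d} {k} DS@(a , m , _ , 1≤d , S≈) DT@(b , suc q , _ , _ , T≈) k≤|S| = begin
  card (S ⊕ T) + k                    ≡⟨ cong (_+ k) (card-cong S⊕T≈) ⟩
  card (ap (a + b) d (m + k * q)) + k ≡⟨ cong (_+ k) (card-ap 1≤d) ⟩
  m + k * q + k                       ≡⟨ carry m k q ⟩
  m + k * suc q                       ≡⟨ sym (cong₂ (λ x y → x + k * y) (card-DetIndex DS) (card-DetIndex DT)) ⟩
  card S + k * card T                 ∎
  where
  open ≡-Reasoning
  S⊕T≈ : (S ⊕ T) ≈ₛ ap (a + b) d (m + k * q)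
  S⊕T≈ = ≈ₛ-trans (⊕-cong S≈ T≈) (ap-⊕-ap a b d q (subst (k ≤_) (card-DetIndex DS) k≤|S|))
  carry : ∀ m k q → m + k * q + k ≡ m + k * suc q
  carry = solve-∀

c≡m*n⇔k≡m : ∀ {c k m n} → 1 < n → c + k ≡ m + k * n → (c ≡ m * n ⇔ k ≡ m)
c≡m*n⇔k≡m {c} {k} {m} {suc n} (s≤s 1≤n) c+k≡ = mk⇔ to from
  where
  open ≡-Reasoning
  to : c ≡ m * suc n → k ≡ m
  to refl = sym (*-cancelʳ-≡ m k n {{>-nonZero 1≤n}} (+-cancelʳ-≡ k _ _ (+-cancelˡ-≡ m _ _ (begin
    m + (m * n + k) ≡⟨ split m k n ⟩
    m * suc n + k   ≡⟨ c+k≡ ⟩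
    m + k * suc n   ≡⟨ cong (m +_) (*-suc′ k n) ⟩
    m + (k * n + k) ∎))))
    where
    split : ∀ m k n → m + (m * n + k) ≡ m * suc n + k
    split = solve-∀
    *-suc′ : ∀ k n → k * suc n ≡ k * n + k
    *-suc′ = solve-∀
  from : k ≡ m → c ≡ m * suc n
  from refl = +-cancelʳ-≡ k c (k * suc n) (trans c+k≡ (+-comm k (k * suc n)))

strong⇔ratio : ∀ {S T d k} → DetIndex S d → DetIndex T (k * d) → k ≤ card S →
               (card (S ⊕ T) ≡ card S * card T ⇔ k ≡ card S)
strong⇔ratio DS DT k≤|S| = c≡m*n⇔k≡m (<⇒≤ (DetIndex⇒3≤card DT)) (card-⊕-DetIndex DS DT k≤|S|)

theorem3p9 : ∀ {n : ℕ} (G : Graph n) (f : Labelling n) →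
    IsBiarithmeticIASI G f →
    (IsStrongIASI G f ⇔ RatioEqualsCard G f)
theorem3p9 G f B = mk⇔ strong⇒ratio (λ R → iasi , ratio⇒strong R)
  where
  open IsBiarithmeticIASI B
  open IsArithmeticIASI arithmetic
  strong⇒ratio : IsStrongIASI G f → RatioEqualsCard G f
  strong⇒ratio (_ , strong) adj {du} Du Dv du≤dv with ratio adj Du Dv du≤dv
  ... | k , refl , _ , k≤|fu| = cong (_* du) (Equivalence.to (strong⇔ratio Du Dv k≤|fu|) (strong adj))
  strong-oriented : RatioEqualsCard G f → ∀ {u v du dv} → Adj G u v →
                    DetIndex (f u) du → DetIndex (f v) dv → du ≤ dv →
                    card (edgeLabel f u v) ≡ card (f u) * card (f v)
  strong-oriented R adj Du Dv du≤dv =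
    Equivalence.from (strong⇔ratio Du (subst (DetIndex _) (R adj Du Dv du≤dv) Dv) ≤-refl) refl
  ratio⇒strong : RatioEqualsCard G f → ∀ {u v} → Adj G u v → card (edgeLabel f u v) ≡ card (f u) * card (f v)
  ratio⇒strong R {u} {v} adj with vertexAP u | vertexAP v
  ... | du , Du | dv , Dv with ≤-total du dv
  ... | inj₁ du≤dv = strong-oriented R adj Du Dv du≤dv
  ... | inj₂ dv≤du = trans (card-cong (⊕-comm (f u) (f v)))
    (trans (strong-oriented R (Graph.sym G adj) Dv Du dv≤du) (*-comm (card (f v)) (card (f u))))
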